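{- Let $k$, $d$ and $l$ be positive integers with $l\le k$, let $d'=d\left(1-\frac{1}{2^l-1}\right)$, and let $x=(x_0,\ldots,x_k)$ be a $(k,d)$-vector. Define $$E(x)=\left(\lfloor x_1/2\rfloor,\lfloor x_2/2\rfloor,\ldots,\lfloor x_k/2\rfloor,\lfloor d'/2\rfloor\right).$$ For $l\le r\le k$ let $C_r(x)$ be the $(k+1)$-tuple consisting of $r+1-l$ zero entries, followed by the entries $\lfloor x_j/(2^l-1)\rfloor$ for $j=r+1,\ldots,k$ (in this order), followed by the entries $\lfloor d'/2^{l-j}\rfloor$ for $j=0,1,\ldots,l-1$ (in this order); and let $C^*_r(x)$ be the $(k+1)$-tuple consisting of the entries $x_j$ for $j=l,l+1,\ldots,r$ (in this order) followed by $k-r+l$ zeros. Then: (a) $E(x)$ is a $(k,d)$-vector, and if $E(x)$ is $(k,d)$-constructible then so is $x$. (b) For every $l\le r\le k$, both $C_r(x)$ and $C^*_r(x)$ are $(k,d)$-vectors; and if both $C_r(x)$ and $C^*_r(x)$ are $(k,d)$-constructible and $|C^*_r(x)|<d/2^l$, then $x$ is also $(k,d)$-constructible.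
   Context: A $(k,d)$-vector is a $(k+1)$-tuple $x=(x_0,\ldots,x_k)$ of non-negative integers with $|x|\le d$, where $|x|=\sum_{j=0}^k x_j$. For a $(k,d)$-vector $x$, a $(k,d,x)$-tree is a finite rooted binary tree in which every non-leaf vertex has exactly two children and which satisfies: (i$'$) for each $j=0,\ldots,k$ there are at most $x_j$ leaves at distance exactly $j$ from the root, and (ii) for every vertex $v$ there are at most $d$ leaves among the descendants of $v$ at distance at most $k$ from $v$. A $(k,d)$-vector $x$ is $(k,d)$-constructible if a $(k,d,x)$-tree exists. -}

module Defs where

open import Data.Nat using (ℕ; zero; suc; _+_; _*_; _∸_; _^_; _≤_; _<_; _/_)
open import Data.Nat.Properties using ()
open import Data.Fin using (Fin; toℕ)
open import Data.Vec using (Vec; lookup; tabulate; toList)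
open import Data.List using (List; []; _∷_; _++_; map; replicate; upTo)
open import Data.Product using (∃; _×_)
open import Data.Nat.ListAction using (sum)

data Tree : Set where
  leaf : Tree
  node : Tree → Tree → Tree

leavesAt : Tree → ℕ → ℕ
leavesAt leaf zero = 1
leavesAt leaf (suc j) = 0
leavesAt (node s t) zero = 0
leavesAt (node s t) (suc j) = leavesAt s j + leavesAt t j

leavesUpTo : Tree → ℕ → ℕ
leavesUpTo t zero = leavesAt t zero
leavesUpTo t (suc k) = leavesUpTo t k + leavesAt t (suc k)

-- P holds at (the subtree rooted at) every vertex
AllVertices : (Tree → Set) → Tree → Set
AllVertices P leaf = P leaf
AllVertices P (node s t) = P (node s t) × AllVertices P s × AllVertices P t

vsum : ∀ {n} → Vec ℕ n → ℕ
vsum {n} v = sum (toList v)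

KDVector : (k d : ℕ) → Vec ℕ (suc k) → Set
KDVector k d x = vsum x ≤ d

KDXTree : (k d : ℕ) → Vec ℕ (suc k) → Tree → Set
KDXTree k d x t =
  ((j : Fin (suc k)) → leavesAt t (toℕ j) ≤ lookup x j)
  × AllVertices (λ v → leavesUpTo v k ≤ d) t

Constructible : (k d : ℕ) → Vec ℕ (suc k) → Set
Constructible k d x = KDVector k d x × ∃ (λ t → KDXTree k d x t)

-- floor division; the divisor 0 case is never used under the hypotheses
_div_ : ℕ → ℕ → ℕ
n div zero = 0
n div (suc m) = n / suc m

-- ⌊ d' / m ⌋ where d' = d (1 - 1/(2^l - 1)) = d (2^l - 2) / (2^l - 1)
floorD' : (d l m : ℕ) → ℕ
floorD' d l m = (d * (2 ^ l ∸ 2)) div ((2 ^ l ∸ 1) * m)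

at : List ℕ → ℕ → ℕ
at [] _ = 0
at (a ∷ as) zero = a
at (a ∷ as) (suc i) = at as i

-- x_j (0 outside range)
xat : ∀ {n} → Vec ℕ n → ℕ → ℕ
xat x j = at (toList x) j

toTuple : (k : ℕ) → List ℕ → Vec ℕ (suc k)
toTuple k L = tabulate (λ i → at L (toℕ i))

Elist : (k d l : ℕ) → Vec ℕ (suc k) → List ℕ
Elist k d l x = map (λ m → xat x (suc m) / 2) (upTo k) ++ (floorD' d l 2 ∷ [])

E : (k d l : ℕ) → Vec ℕ (suc k) → Vec ℕ (suc k)
E k d l x = toTuple k (Elist k d l x)

Clist : (k d l r : ℕ) → Vec ℕ (suc k) → List ℕ
Clist k d l r x =
  replicate (suc r ∸ l) 0
  ++ map (λ m → xat x (suc r + m) div (2 ^ l ∸ 1)) (upTo (k ∸ r))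
  ++ map (λ j → floorD' d l (2 ^ (l ∸ j))) (upTo l)

C : (k d l r : ℕ) → Vec ℕ (suc k) → Vec ℕ (suc k)
C k d l r x = toTuple k (Clist k d l r x)

C*list : (k l r : ℕ) → Vec ℕ (suc k) → List ℕ
C*list k l r x =
  map (λ m → xat x (l + m)) (upTo (suc r ∸ l)) ++ replicate ((k ∸ r) + l) 0

C* : (k l r : ℕ) → Vec ℕ (suc k) → Vec ℕ (suc k)
C* k l r x = toTuple k (C*list k l r x)

-- (a) Two copies of a tree for E(x) under a new root give level j+1 at most
-- 2⌊x_{j+1}/2⌋ ≤ x_{j+1} leaves, and the new root sees at most 2 Σ ⌊x_j/2⌋ ≤ |x| ≤ d leaves.
-- (b) Put a tree S for C*_r(x) at the bottom of a path of length l and hang, at the path vertex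
-- of depth l-1-i, a complete binary tree of depth i with a tree T for C_r(x) at each leaf.
-- Level l+j then gets S_j + (2^l-1) T_j leaves, which is at most x_{l+j} by the shapes of
-- C_r and C*_r. The trailing entries ⌊d'/2^(l-j)⌋ of C_r(x) bound the leaves of T that fall
-- into the depth-k window of a new vertex; with |C*_r(x)| < d/2^l and d' = d(2^l-2)/(2^l-1)
-- this keeps every such window below d.

module Submission where

open import Defs
open import Data.Nat
open import Data.Nat.Properties
open import Algebra.Properties.CommutativeSemigroup +-commutativeSemigroup using (interchange)
open import Data.Nat.DivMod using (m/n*n≤m)
open import Data.Nat.ListAction using (sum)
open import Data.Nat.ListAction.Properties using (sum-++)
open import Data.Nat.Tactic.RingSolver using (solve)
open import Data.Fin using (Fin; toℕ; fromℕ<)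
open import Data.Fin.Properties using (toℕ<n; toℕ-fromℕ<)
open import Data.List using (List; []; _∷_; _++_; map; replicate; applyUpTo; upTo; length)
open import Data.List.Properties using (map-upTo; length-map; length-upTo; length-replicate)
open import Data.Vec using (Vec; lookup; tabulate; toList)
open import Data.Vec.Properties using (lookup∘tabulate)
open import Data.Product using (∃; _×_; _,_)
open import Function using (_∘_)
open import Relation.Binary.PropositionalEquality
open import Relation.Nullary using (yes; no)

sumUpTo : (ℕ → ℕ) → ℕ → ℕ
sumUpTo f n = sum (applyUpTo f n)

sumUpTo-mono-≤ : ∀ {f g} n → (∀ j → j < n → f j ≤ g j) → sumUpTo f n ≤ sumUpTo g n
sumUpTo-mono-≤ zero    _ = z≤n
sumUpTo-mono-≤ (suc n) h = +-mono-≤ (h 0 z<s) (sumUpTo-mono-≤ n (λ j j<n → h (suc j) (s<s j<n)))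

sumUpTo-cong : ∀ {f g} n → (∀ j → j < n → f j ≡ g j) → sumUpTo f n ≡ sumUpTo g n
sumUpTo-cong zero    _ = refl
sumUpTo-cong (suc n) h = cong₂ _+_ (h 0 z<s) (sumUpTo-cong n (λ j j<n → h (suc j) (s<s j<n)))

sumUpTo-+ : ∀ f g n → sumUpTo (λ j → f j + g j) n ≡ sumUpTo f n + sumUpTo g n
sumUpTo-+ f g zero    = refl
sumUpTo-+ f g (suc n) =
  trans (cong (f 0 + g 0 +_) (sumUpTo-+ (f ∘ suc) (g ∘ suc) n)) (interchange (f 0) (g 0) _ _)

sumUpTo-*ˡ : ∀ c f n → sumUpTo (λ j → c * f j) n ≡ c * sumUpTo f n
sumUpTo-*ˡ c f zero    = sym (*-zeroʳ c)
sumUpTo-*ˡ c f (suc n) =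
  trans (cong (c * f 0 +_) (sumUpTo-*ˡ c (f ∘ suc) n)) (sym (*-distribˡ-+ c (f 0) _))

sumUpTo-*ʳ : ∀ f c n → sumUpTo (λ j → f j * c) n ≡ sumUpTo f n * c
sumUpTo-*ʳ f c n =
  trans (sumUpTo-cong n (λ j _ → *-comm (f j) c)) (trans (sumUpTo-*ˡ c f n) (*-comm c _))

sumUpTo-+-split : ∀ f m n → sumUpTo f (m + n) ≡ sumUpTo f m + sumUpTo (λ j → f (m + j)) n
sumUpTo-+-split f zero    n = refl
sumUpTo-+-split f (suc m) n =
  trans (cong (f 0 +_) (sumUpTo-+-split (f ∘ suc) m n)) (sym (+-assoc (f 0) _ _))

sumUpTo-suc : ∀ f n → sumUpTo f (suc n) ≡ sumUpTo f n + f n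
sumUpTo-suc f zero    = +-comm (f 0) 0
sumUpTo-suc f (suc n) = trans (cong (f 0 +_) (sumUpTo-suc (f ∘ suc) n)) (sym (+-assoc (f 0) _ _))

sumUpTo-monoʳ-≤ : ∀ f {m n} → m ≤ n → sumUpTo f m ≤ sumUpTo f n
sumUpTo-monoʳ-≤ f {m} m≤n with m≤n⇒∃[o]m+o≡n m≤n
... | o , refl = ≤-trans (m≤m+n (sumUpTo f m) _) (≤-reflexive (sym (sumUpTo-+-split f m o)))

sumUpTo-at≤sum : ∀ L n → sumUpTo (at L) n ≤ sum L
sumUpTo-at≤sum []      zero    = z≤n
sumUpTo-at≤sum []      (suc n) = sumUpTo-at≤sum [] n
sumUpTo-at≤sum (a ∷ L) zero    = z≤n
sumUpTo-at≤sum (a ∷ L) (suc n) = +-monoʳ-≤ a (sumUpTo-at≤sum L n)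

sumUpTo-at-++ : ∀ P Q {m} n → length P ≡ m → sumUpTo (at (P ++ Q)) (m + n) ≡ sum P + sumUpTo (at Q) n
sumUpTo-at-++ []      Q n refl = refl
sumUpTo-at-++ (a ∷ P) Q n refl = trans (cong (a +_) (sumUpTo-at-++ P Q n refl)) (sym (+-assoc a _ _))

at-++ˡ : ∀ P Q {m j} → length P ≡ m → j < m → at (P ++ Q) j ≡ at P j
at-++ˡ (a ∷ P) Q {j = zero}  refl _         = refl
at-++ˡ (a ∷ P) Q {j = suc j} refl (s<s j<n) = at-++ˡ P Q refl j<n

at-++ʳ : ∀ P Q {m} j → length P ≡ m → at (P ++ Q) (m + j) ≡ at Q j
at-++ʳ []      Q j refl = refl
at-++ʳ (a ∷ P) Q j refl = at-++ʳ P Q j refl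

at-replicate-0 : ∀ n j → at (replicate n 0) j ≡ 0
at-replicate-0 zero    j       = refl
at-replicate-0 (suc n) zero    = refl
at-replicate-0 (suc n) (suc j) = at-replicate-0 n j

sum-replicate-0 : ∀ n → sum (replicate n 0) ≡ 0
sum-replicate-0 zero    = refl
sum-replicate-0 (suc n) = sum-replicate-0 n

at-applyUpTo : ∀ f {n j} → j < n → at (applyUpTo f n) j ≡ f j
at-applyUpTo f {suc n} {zero}  _         = refl
at-applyUpTo f {suc n} {suc j} (s<s j<n) = at-applyUpTo (f ∘ suc) j<n

at-map-upTo : ∀ f {n j} → j < n → at (map f (upTo n)) j ≡ f j
at-map-upTo f {n} j<n = trans (cong (λ L → at L _) (map-upTo f n)) (at-applyUpTo f j<n)

sum-map-upTo : ∀ f n → sum (map f (upTo n)) ≡ sumUpTo f n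
sum-map-upTo f n = cong sum (map-upTo f n)

length-map-upTo : ∀ (f : ℕ → ℕ) n → length (map f (upTo n)) ≡ n
length-map-upTo f n = trans (length-map f (upTo n)) (length-upTo n)

vsum-tabulate : ∀ n g → vsum (tabulate {n = n} (g ∘ toℕ)) ≡ sumUpTo g n
vsum-tabulate zero    g = refl
vsum-tabulate (suc n) g = cong (g 0 +_) (vsum-tabulate n (g ∘ suc))

vsum-toTuple-≤ : ∀ k L → vsum (toTuple k L) ≤ sum L
vsum-toTuple-≤ k L = subst (_≤ sum L) (sym (vsum-tabulate (suc k) (at L))) (sumUpTo-at≤sum L (suc k))

sumUpTo-xat-from≤vsum : ∀ {n} (x : Vec ℕ n) m i → sumUpTo (λ j → xat x (m + j)) i ≤ vsum x
sumUpTo-xat-from≤vsum x m i = begin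
  sumUpTo (λ j → xat x (m + j)) i                       ≤⟨ m≤n+m _ _ ⟩
  sumUpTo (xat x) m + sumUpTo (λ j → xat x (m + j)) i   ≡⟨ sumUpTo-+-split (xat x) m i ⟨
  sumUpTo (xat x) (m + i)                               ≤⟨ sumUpTo-at≤sum (toList x) (m + i) ⟩
  vsum x                                                ∎
  where open ≤-Reasoning

Levels≤ : Tree → (ℕ → ℕ) → ℕ → Set
Levels≤ t f n = ∀ j → j < n → leavesAt t j ≤ f j

levels≤-toTuple : ∀ k L t → ((j : Fin (suc k)) → leavesAt t (toℕ j) ≤ lookup (toTuple k L) j) →
  Levels≤ t (at L) (suc k)
levels≤-toTuple k L t h j j<k = subst (λ i → leavesAt t i ≤ at L i) (toℕ-fromℕ< j<k)
  (subst (leavesAt t _ ≤_) (lookup∘tabulate (at L ∘ toℕ) (fromℕ< j<k)) (h (fromℕ< j<k)))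

lookup≡xat : ∀ {n} (x : Vec ℕ n) j → lookup x j ≡ xat x (toℕ j)
lookup≡xat (a Vec.∷ x) Fin.zero    = refl
lookup≡xat (a Vec.∷ x) (Fin.suc j) = lookup≡xat x j

levels≤-vec : ∀ k (x : Vec ℕ (suc k)) t → Levels≤ t (xat x) (suc k) →
  (j : Fin (suc k)) → leavesAt t (toℕ j) ≤ lookup x j
levels≤-vec k x t h j = subst (leavesAt t (toℕ j) ≤_) (sym (lookup≡xat x j)) (h (toℕ j) (toℕ<n j))

Sparse : ℕ → ℕ → Tree → Set
Sparse k d = AllVertices (λ v → leavesUpTo v k ≤ d)

tree-of-constructible : ∀ k d L → Constructible k d (toTuple k L) →
  ∃ λ t → Levels≤ t (at L) (suc k) × Sparse k d t
tree-of-constructible k d L (_ , t , levels , sparse) = t , levels≤-toTuple k L t levels , sparse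

constructible-of-tree : ∀ k d (x : Vec ℕ (suc k)) t → KDVector k d x →
  Levels≤ t (xat x) (suc k) → Sparse k d t → Constructible k d x
constructible-of-tree k d x t kd levels sparse = kd , t , levels≤-vec k x t levels , sparse

leavesBelow : Tree → ℕ → ℕ
leavesBelow t = sumUpTo (leavesAt t)

leavesUpTo≡leavesBelow : ∀ t k → leavesUpTo t k ≡ leavesBelow t (suc k)
leavesUpTo≡leavesBelow t zero    = sym (+-identityʳ _)
leavesUpTo≡leavesBelow t (suc k) =
  trans (cong (_+ leavesAt t (suc k)) (leavesUpTo≡leavesBelow t k)) (sym (sumUpTo-suc (leavesAt t) (suc k)))

leavesBelow-node : ∀ s t n → leavesBelow (node s t) (suc n) ≡ leavesBelow s n + leavesBelow t n
leavesBelow-node s t = sumUpTo-+ (leavesAt s) (leavesAt t)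

sumUpTo-0 : ∀ n → sumUpTo (λ _ → 0) n ≡ 0
sumUpTo-0 zero    = refl
sumUpTo-0 (suc n) = sumUpTo-0 n

leavesBelow-shift : ∀ u n m → (∀ j → j < n → leavesAt u j ≡ 0) →
  leavesBelow u (n + m) ≡ sumUpTo (λ i → leavesAt u (n + i)) m
leavesBelow-shift u n m empty = trans (sumUpTo-+-split (leavesAt u) n m)
  (cong (_+ sumUpTo (λ i → leavesAt u (n + i)) m) (trans (sumUpTo-cong n empty) (sumUpTo-0 n)))

full : ℕ → Tree → Tree
full zero    t = t
full (suc n) t = node (full n t) (full n t)

spine : ℕ → Tree → Tree → Tree
spine zero    s t = s
spine (suc n) s t = node (spine n s t) (full n t)

mersenne : ℕ → ℕ
mersenne = sumUpTo (2 ^_)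

suc-mersenne : ∀ n → suc (mersenne n) ≡ 2 ^ n
suc-mersenne zero    = refl
suc-mersenne (suc n) = begin
  suc (mersenne (suc n))     ≡⟨ cong suc (sumUpTo-suc (2 ^_) n) ⟩
  suc (mersenne n) + 2 ^ n   ≡⟨ cong (_+ 2 ^ n) (suc-mersenne n) ⟩
  2 ^ n + 2 ^ n              ≡⟨ cong (2 ^ n +_) (+-identityʳ (2 ^ n)) ⟨
  2 ^ suc n                  ∎
  where open ≡-Reasoning

leavesAt-full-< : ∀ n t {j} → j < n → leavesAt (full n t) j ≡ 0
leavesAt-full-< (suc n) t {zero}  _         = refl
leavesAt-full-< (suc n) t {suc j} (s<s j<n) = cong₂ _+_ (leavesAt-full-< n t j<n) (leavesAt-full-< n t j<n)

double≡2* : ∀ m → m + m ≡ 2 * m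
double≡2* m = cong (m +_) (sym (+-identityʳ m))

leavesAt-full : ∀ n t i → leavesAt (full n t) (n + i) ≡ 2 ^ n * leavesAt t i
leavesAt-full zero    t i = sym (+-identityʳ _)
leavesAt-full (suc n) t i = begin
  leavesAt (full n t) (n + i) + leavesAt (full n t) (n + i)  ≡⟨ cong (λ m → m + m) (leavesAt-full n t i) ⟩
  2 ^ n * leavesAt t i + 2 ^ n * leavesAt t i                ≡⟨ double≡2* (2 ^ n * leavesAt t i) ⟩
  2 * (2 ^ n * leavesAt t i)                                 ≡⟨ *-assoc 2 (2 ^ n) _ ⟨
  2 ^ suc n * leavesAt t i                                   ∎
  where open ≡-Reasoning

leavesBelow-full : ∀ n t m → leavesBelow (full n t) (n + m) ≡ 2 ^ n * leavesBelow t m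
leavesBelow-full n t m = trans (leavesBelow-shift (full n t) n m (λ _ → leavesAt-full-< n t))
  (trans (sumUpTo-cong m (λ i _ → leavesAt-full n t i)) (sumUpTo-*ˡ (2 ^ n) (leavesAt t) m))

leavesAt-spine-< : ∀ n s t {j} → j < n → leavesAt (spine n s t) j ≡ 0
leavesAt-spine-< (suc n) s t {zero}  _         = refl
leavesAt-spine-< (suc n) s t {suc j} (s<s j<n) = cong₂ _+_ (leavesAt-spine-< n s t j<n) (leavesAt-full-< n t j<n)

leavesAt-spine : ∀ n s t i → leavesAt (spine n s t) (n + i) ≡ leavesAt s i + mersenne n * leavesAt t i
leavesAt-spine zero    s t i = sym (+-identityʳ _)
leavesAt-spine (suc n) s t i = begin
  leavesAt (spine n s t) (n + i) + leavesAt (full n t) (n + i)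
    ≡⟨ cong₂ _+_ (leavesAt-spine n s t i) (leavesAt-full n t i) ⟩
  leavesAt s i + mersenne n * leavesAt t i + 2 ^ n * leavesAt t i
    ≡⟨ +-assoc (leavesAt s i) _ _ ⟩
  leavesAt s i + (mersenne n * leavesAt t i + 2 ^ n * leavesAt t i)
    ≡⟨ cong (leavesAt s i +_) (*-distribʳ-+ (leavesAt t i) (mersenne n) (2 ^ n)) ⟨
  leavesAt s i + (mersenne n + 2 ^ n) * leavesAt t i
    ≡⟨ cong (λ c → leavesAt s i + c * leavesAt t i) (sumUpTo-suc (2 ^_) n) ⟨
  leavesAt s i + mersenne (suc n) * leavesAt t i
    ∎
  where open ≡-Reasoning

leavesBelow-spine : ∀ n s t m →
  leavesBelow (spine n s t) (n + m) ≡ leavesBelow s m + mersenne n * leavesBelow t m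
leavesBelow-spine n s t m = begin
  leavesBelow (spine n s t) (n + m)
    ≡⟨ leavesBelow-shift (spine n s t) n m (λ _ → leavesAt-spine-< n s t) ⟩
  sumUpTo (λ i → leavesAt (spine n s t) (n + i)) m
    ≡⟨ sumUpTo-cong m (λ i _ → leavesAt-spine n s t i) ⟩
  sumUpTo (λ i → leavesAt s i + mersenne n * leavesAt t i) m
    ≡⟨ sumUpTo-+ (leavesAt s) _ m ⟩
  leavesBelow s m + sumUpTo (λ i → mersenne n * leavesAt t i) m
    ≡⟨ cong (leavesBelow s m +_) (sumUpTo-*ˡ (mersenne n) (leavesAt t) m) ⟩
  leavesBelow s m + mersenne n * leavesBelow t m
    ∎
  where open ≡-Reasoning

allVertices-full : ∀ (P : Tree → Set) n t → AllVertices P t → (∀ i → i ≤ n → P (full i t)) →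
  AllVertices P (full n t)
allVertices-full P zero    t all-t _      = all-t
allVertices-full P (suc n) t all-t at-fulls = at-fulls (suc n) ≤-refl , below , below
  where below = allVertices-full P n t all-t (λ i i≤n → at-fulls i (m≤n⇒m≤1+n i≤n))

allVertices-spine : ∀ (P : Tree → Set) n s t → AllVertices P s → AllVertices P t →
  (∀ i → i < n → P (full i t)) → (∀ i → i ≤ n → P (spine i s t)) → AllVertices P (spine n s t)
allVertices-spine P zero    s t all-s all-t _        _         = all-s
allVertices-spine P (suc n) s t all-s all-t at-fulls at-spines =
  at-spines (suc n) ≤-refl ,
  allVertices-spine P n s t all-s all-t (λ i i<n → at-fulls i (m<n⇒m<1+n i<n)) (λ i i≤n → at-spines i (m≤n⇒m≤1+n i≤n)) ,
  allVertices-full P n t all-t (λ i i≤n → at-fulls i (s≤s i≤n))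

div-*-≤ : ∀ n m → n div m * m ≤ n
div-*-≤ n zero    = z≤n
div-*-≤ n (suc m) = m/n*n≤m n (suc m)

half-+-half≤ : ∀ n → n / 2 + n / 2 ≤ n
half-+-half≤ n = subst (_≤ n) (trans (*-comm (n / 2) 2) (sym (double≡2* (n / 2)))) (m/n*n≤m n 2)

halves-+-≤ : ∀ {a b d} → a * 2 ≤ d → b * 2 ≤ d → a + b ≤ d
halves-+-≤ {a} {b} {d} a2≤d b2≤d = *-cancelʳ-≤ (a + b) d 2 (begin
  (a + b) * 2    ≡⟨ *-distribʳ-+ 2 a b ⟩
  a * 2 + b * 2  ≤⟨ +-mono-≤ a2≤d b2≤d ⟩
  d + d          ≡⟨ trans (double≡2* d) (*-comm 2 d) ⟩
  d * 2          ∎)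
  where open ≤-Reasoning

-- In part (b) these are used with 2 + N = 2^l, I = 2^i, P = 2^(l-i), c = 2^i - 1, so that
-- d N / (1 + N) = d'; they bound the windows of the vertices full i T and spine i S T.
full-bound : ∀ {I P N d X Y} → 2 ≤ P → I * P ≡ 2 + N → X * (1 + N) ≤ d →
  Y * ((1 + N) * (2 + N)) + d * N ≤ d * N * P → I * (X + Y) ≤ d
full-bound {I} {suc (suc b)} {N} {d} {X} {Y} (s≤s (s≤s _)) I*P≡L hX hY =
  *-cancelʳ-≤ _ d ((1 + N) * (2 + b)) (+-cancelʳ-≤ (d * N) _ _ (begin
    I * (X + Y) * ((1 + N) * (2 + b)) + d * N
      ≡⟨ solve (I ∷ b ∷ N ∷ X ∷ Y ∷ d ∷ []) ⟩
    I * (2 + b) * (X * (1 + N)) + (Y * ((1 + N) * (I * (2 + b))) + d * N)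
      ≡⟨ cong (λ L → L * (X * (1 + N)) + (Y * ((1 + N) * L) + d * N)) I*P≡L ⟩
    (2 + N) * (X * (1 + N)) + (Y * ((1 + N) * (2 + N)) + d * N)
      ≤⟨ +-mono-≤ (*-monoʳ-≤ (2 + N) hX) hY ⟩
    (2 + N) * d + d * N * (2 + b)
      ≤⟨ m≤m+n _ (b * d) ⟩
    (2 + N) * d + d * N * (2 + b) + b * d
      ≡⟨ solve (b ∷ N ∷ d ∷ []) ⟩
    d * ((1 + N) * (2 + b)) + d * N
      ∎))
  where open ≤-Reasoning

spine-bound : ∀ {c P N d A V X Y} → P * (1 + c) ≡ 2 + N → V * (2 + N) ≤ d → A + V ≤ d →
  X * (1 + N) ≤ A → Y * ((1 + N) * (2 + N)) + d * N ≤ d * N * P → V + c * (X + Y) ≤ d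
spine-bound {c} {suc b} {N} {d} {A} {V} {X} {Y} P*I≡L hV hAV hX hY =
  *-cancelʳ-≤ _ d ((1 + N) * (2 + N)) (+-cancelʳ-≤ (c * (d * N)) _ _ (begin
    (V + c * (X + Y)) * ((1 + N) * (2 + N)) + c * (d * N)
      ≡⟨ solve (c ∷ N ∷ V ∷ X ∷ Y ∷ d ∷ []) ⟩
    c * (2 + N) * (X * (1 + N)) + c * (Y * ((1 + N) * (2 + N)) + d * N) + V * (2 + N) * (1 + N)
      ≤⟨ +-monoˡ-≤ _ (+-mono-≤ (*-monoʳ-≤ (c * (2 + N)) hX) (*-monoʳ-≤ c hY)) ⟩
    c * (2 + N) * A + c * (d * N * (1 + b)) + V * (2 + N) * (1 + N)
      ≡⟨ cong (λ M → c * (2 + N) * A + c * (d * N * (1 + b)) + V * (2 + N) * M) 1+N≡ ⟩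
    c * (2 + N) * A + c * (d * N * (1 + b)) + V * (2 + N) * (c + b * (1 + c))
      ≡⟨ solve (c ∷ b ∷ N ∷ A ∷ V ∷ d ∷ []) ⟩
    c * (2 + N) * (A + V) + c * (d * N * (1 + b)) + b * (1 + c) * (V * (2 + N))
      ≤⟨ +-mono-≤ (+-monoˡ-≤ _ (*-monoʳ-≤ (c * (2 + N)) hAV)) (*-monoʳ-≤ (b * (1 + c)) hV) ⟩
    c * (2 + N) * d + c * (d * N * (1 + b)) + b * (1 + c) * d
      ≤⟨ m≤m+n _ (b * (1 + c + N) * d) ⟩
    c * (2 + N) * d + c * (d * N * (1 + b)) + b * (1 + c) * d + b * (1 + c + N) * d
      ≡⟨ solve (c ∷ b ∷ N ∷ d ∷ []) ⟩
    d * ((c + b * (1 + c)) * (2 + N)) + c * (d * N)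
      ≡⟨ cong (λ M → d * (M * (2 + N)) + c * (d * N)) 1+N≡ ⟨
    d * ((1 + N) * (2 + N)) + c * (d * N)
      ∎))
  where
  open ≤-Reasoning
  1+N≡ : 1 + N ≡ c + b * (1 + c)
  1+N≡ = sym (suc-injective P*I≡L)

2≤2^ : ∀ {l} → 1 ≤ l → 2 ≤ 2 ^ l
2≤2^ 1≤l = ^-monoʳ-≤ 2 1≤l

floorD'-bound : ∀ d l m → floorD' d l m * ((2 ^ l ∸ 1) * m) ≤ d * (2 ^ l ∸ 2)
floorD'-bound d l m = div-*-≤ (d * (2 ^ l ∸ 2)) ((2 ^ l ∸ 1) * m)

2^≡2+2^∸2 : ∀ {l} → 1 ≤ l → 2 ^ l ≡ 2 + (2 ^ l ∸ 2)
2^≡2+2^∸2 1≤l = sym (m+[n∸m]≡n (2≤2^ 1≤l))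

2^∸1≡1+2^∸2 : ∀ {l} → 1 ≤ l → 2 ^ l ∸ 1 ≡ 1 + (2 ^ l ∸ 2)
2^∸1≡1+2^∸2 1≤l = +-∸-assoc 1 (2≤2^ 1≤l)

2^[l∸i]*2^i≡2^l : ∀ {i l} → i ≤ l → 2 ^ (l ∸ i) * 2 ^ i ≡ 2 ^ l
2^[l∸i]*2^i≡2^l {i} {l} i≤l = trans (sym (^-distribˡ-+-* 2 (l ∸ i) i)) (cong (2 ^_) (m∸n+n≡m i≤l))

floorD'-half : ∀ d l → 1 ≤ l → floorD' d l 2 * 2 ≤ d
floorD'-half d l 1≤l = *-cancelʳ-≤ _ d (1 + N) (begin
  floorD' d l 2 * 2 * (1 + N)       ≡⟨ trans (*-assoc (floorD' d l 2) 2 _) (cong (floorD' d l 2 *_) (*-comm 2 (1 + N))) ⟩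
  floorD' d l 2 * ((1 + N) * 2)     ≡⟨ cong (λ M → floorD' d l 2 * (M * 2)) (2^∸1≡1+2^∸2 1≤l) ⟨
  floorD' d l 2 * ((2 ^ l ∸ 1) * 2) ≤⟨ floorD'-bound d l 2 ⟩
  d * N                             ≤⟨ *-monoʳ-≤ d (n≤1+n N) ⟩
  d * (1 + N)                       ∎)
  where
  open ≤-Reasoning
  N = 2 ^ l ∸ 2

blocks-length : ∀ {i l r k} → i ≤ l → l ≤ r → r ≤ k → suc r ∸ l + (k ∸ r + (l ∸ i)) ≡ suc k ∸ i
blocks-length {i} i≤l l≤r r≤k with m≤n⇒∃[o]m+o≡n i≤l
... | u , refl with m≤n⇒∃[o]m+o≡n l≤r
... | v , refl with m≤n⇒∃[o]m+o≡n r≤k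
... | w , refl = begin
  suc (i + u + v) ∸ (i + u) + (i + u + v + w ∸ (i + u + v) + (i + u ∸ i))
    ≡⟨ cong₂ _+_ (cong (_∸ (i + u)) (solve (i ∷ u ∷ v ∷ []))) (cong₂ _+_ (m+n∸m≡n (i + u + v) w) (m+n∸m≡n i u)) ⟩
  (i + u) + suc v ∸ (i + u) + (w + u)
    ≡⟨ cong (_+ (w + u)) (m+n∸m≡n (i + u) (suc v)) ⟩
  suc v + (w + u)
    ≡⟨ solve (u ∷ v ∷ w ∷ []) ⟩
  suc (u + v + w)
    ≡⟨ m+n∸m≡n i (suc (u + v + w)) ⟨
  i + suc (u + v + w) ∸ i
    ≡⟨ cong (_∸ i) (solve (i ∷ u ∷ v ∷ w ∷ [])) ⟩
  suc (i + u + v + w) ∸ i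
    ∎
  where open ≡-Reasoning

module ViaE (k d l : ℕ) (1≤l : 1 ≤ l) (x : Vec ℕ (suc k)) (x-kd : KDVector k d x) where

  half-x : ℕ → ℕ
  half-x j = xat x (suc j) / 2

  halves≤d : sumUpTo half-x k + sumUpTo half-x k ≤ d
  halves≤d = begin
    sumUpTo half-x k + sumUpTo half-x k       ≡⟨ sumUpTo-+ half-x half-x k ⟨
    sumUpTo (λ j → half-x j + half-x j) k     ≤⟨ sumUpTo-mono-≤ k (λ j _ → half-+-half≤ (xat x (suc j))) ⟩
    sumUpTo (λ j → xat x (1 + j)) k           ≤⟨ sumUpTo-xat-from≤vsum x 1 k ⟩
    vsum x                                    ≤⟨ x-kd ⟩
    d                                         ∎
    where open ≤-Reasoning

  E-at : ∀ {j} → j < k → at (Elist k d l x) j ≡ half-x j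
  E-at j<k = trans (at-++ˡ (map half-x (upTo k)) _ (length-map-upTo half-x k) j<k)
    (at-map-upTo half-x j<k)

  E-kd : KDVector k d (E k d l x)
  E-kd = ≤-trans (vsum-toTuple-≤ k (Elist k d l x)) (subst (_≤ d) (sym sum-E)
    (halves-+-≤ {S} {floorD' d l 2} (subst (_≤ d) (trans (double≡2* S) (*-comm 2 S)) halves≤d) (floorD'-half d l 1≤l)))
    where
    S = sumUpTo half-x k
    sum-E : sum (Elist k d l x) ≡ S + floorD' d l 2
    sum-E = trans (sum-++ (map half-x (upTo k)) _)
      (cong₂ _+_ (sum-map-upTo half-x k) (+-identityʳ (floorD' d l 2)))

  E-constructible⇒ : Constructible k d (E k d l x) → Constructible k d x
  E-constructible⇒ E-cons with tree-of-constructible k d (Elist k d l x) E-cons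
  ... | t , t-levels , t-sparse =
    constructible-of-tree k d x (node t t) x-kd levels (root , t-sparse , t-sparse)
    where
    t-level : ∀ {j} → j < k → leavesAt t j ≤ half-x j
    t-level j<k = subst (leavesAt t _ ≤_) (E-at j<k) (t-levels _ (m<n⇒m<1+n j<k))

    levels : Levels≤ (node t t) (xat x) (suc k)
    levels zero    _         = z≤n
    levels (suc j) (s<s j<k) = ≤-trans (+-mono-≤ (t-level j<k) (t-level j<k)) (half-+-half≤ (xat x (suc j)))

    root : leavesUpTo (node t t) k ≤ d
    root = begin
      leavesUpTo (node t t) k             ≡⟨ trans (leavesUpTo≡leavesBelow (node t t) k) (leavesBelow-node t t k) ⟩
      leavesBelow t k + leavesBelow t k   ≤⟨ +-mono-≤ below below ⟩
      sumUpTo half-x k + sumUpTo half-x k ≤⟨ halves≤d ⟩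
      d                                   ∎
      where
      open ≤-Reasoning
      below = sumUpTo-mono-≤ k (λ j → t-level)

module ViaC (k d l : ℕ) (1≤l : 1 ≤ l) (x : Vec ℕ (suc k)) (x-kd : KDVector k d x)
            (r : ℕ) (l≤r : l ≤ r) (r≤k : r ≤ k) where

  s N : ℕ
  s = suc r ∸ l
  N = 2 ^ l ∸ 2

  head-x tail-x q c : ℕ → ℕ
  head-x j = xat x (l + j)
  tail-x j = xat x (suc r + j)
  q j = xat x (suc r + j) div (2 ^ l ∸ 1)
  c j = floorD' d l (2 ^ (l ∸ j))

  Zs Qs Cs Hs Zs* : List ℕ
  Zs  = replicate s 0
  Qs  = map q (upTo (k ∸ r))
  Cs  = map c (upTo l)
  Hs  = map head-x (upTo s)
  Zs* = replicate (k ∸ r + l) 0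

  A B X V : ℕ
  A = sumUpTo tail-x (k ∸ r)
  B = sumUpTo head-x s
  X = sumUpTo q (k ∸ r)
  V = vsum (C* k l r x)

  Y : ℕ → ℕ
  Y = sumUpTo c

  l+s≡1+r : l + s ≡ suc r
  l+s≡1+r = m+[n∸m]≡n (m≤n⇒m≤1+n l≤r)

  head-x-s+ : ∀ j → head-x (s + j) ≡ tail-x j
  head-x-s+ j = cong (xat x) (trans (sym (+-assoc l s j)) (cong (_+ j) l+s≡1+r))

  A+B≤d : A + B ≤ d
  A+B≤d = begin
    A + B                                 ≡⟨ +-comm A B ⟩
    B + A                                 ≡⟨ cong (B +_) (sumUpTo-cong (k ∸ r) (λ j _ → head-x-s+ j)) ⟨
    B + sumUpTo (λ j → head-x (s + j)) (k ∸ r) ≡⟨ sumUpTo-+-split head-x s (k ∸ r) ⟨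
    sumUpTo head-x (s + (k ∸ r))          ≤⟨ sumUpTo-xat-from≤vsum x l (s + (k ∸ r)) ⟩
    vsum x                                ≤⟨ x-kd ⟩
    d                                     ∎
    where open ≤-Reasoning

  X*M≤A : X * (1 + N) ≤ A
  X*M≤A = subst (λ M → X * M ≤ A) (2^∸1≡1+2^∸2 1≤l)
    (subst (_≤ A) (sumUpTo-*ʳ q (2 ^ l ∸ 1) (k ∸ r))
      (sumUpTo-mono-≤ (k ∸ r) (λ j _ → div-*-≤ (tail-x j) (2 ^ l ∸ 1))))

  Y-bound : ∀ {p} → p ≤ l → Y p * ((1 + N) * (2 + N)) + d * N ≤ d * N * 2 ^ p
  Y-bound {p} p≤l = begin
    Y p * ((1 + N) * (2 + N)) + d * N         ≡⟨ cong (_+ d * N) (sumUpTo-*ʳ c _ p) ⟨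
    sumUpTo (λ j → c j * ((1 + N) * (2 + N))) p + d * N
      ≤⟨ +-monoˡ-≤ (d * N) (sumUpTo-mono-≤ p (λ j j<p → c-bound (≤-trans (<⇒≤ j<p) p≤l))) ⟩
    sumUpTo (λ j → d * N * 2 ^ j) p + d * N   ≡⟨ cong (_+ d * N) (sumUpTo-*ˡ (d * N) (2 ^_) p) ⟩
    d * N * mersenne p + d * N                ≡⟨ trans (+-comm _ (d * N)) (sym (*-suc (d * N) (mersenne p))) ⟩
    d * N * suc (mersenne p)                  ≡⟨ cong (d * N *_) (suc-mersenne p) ⟩
    d * N * 2 ^ p                             ∎
    where
    open ≤-Reasoning
    c-bound : ∀ {j} → j ≤ l → c j * ((1 + N) * (2 + N)) ≤ d * N * 2 ^ j
    c-bound {j} j≤l = begin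
      c j * ((1 + N) * (2 + N))                  ≡⟨ cong (λ L → c j * ((1 + N) * L)) (2^≡2+2^∸2 1≤l) ⟨
      c j * ((1 + N) * 2 ^ l)                    ≡⟨ cong (λ L → c j * ((1 + N) * L)) (2^[l∸i]*2^i≡2^l j≤l) ⟨
      c j * ((1 + N) * (2 ^ (l ∸ j) * 2 ^ j))    ≡⟨ trans (*-assoc (c j) _ (2 ^ j)) (cong (c j *_) (*-assoc (1 + N) (2 ^ (l ∸ j)) (2 ^ j))) ⟨
      c j * ((1 + N) * 2 ^ (l ∸ j)) * 2 ^ j      ≡⟨ cong (λ M → c j * (M * 2 ^ (l ∸ j)) * 2 ^ j) (2^∸1≡1+2^∸2 1≤l) ⟨
      c j * ((2 ^ l ∸ 1) * 2 ^ (l ∸ j)) * 2 ^ j  ≤⟨ *-monoˡ-≤ (2 ^ j) (floorD'-bound d l (2 ^ (l ∸ j))) ⟩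
      d * N * 2 ^ j                              ∎

  length-Zs : length Zs ≡ s
  length-Zs = length-replicate s

  length-Qs : length Qs ≡ k ∸ r
  length-Qs = length-map-upTo q (k ∸ r)

  length-Hs : length Hs ≡ s
  length-Hs = length-map-upTo head-x s

  C-at-head : ∀ {i} → i < s → at (Clist k d l r x) i ≡ 0
  C-at-head {i} i<s = trans (at-++ˡ Zs (Qs ++ Cs) length-Zs i<s) (at-replicate-0 s i)

  C-at-tail : ∀ {m} → m < k ∸ r → at (Clist k d l r x) (s + m) ≡ q m
  C-at-tail {m} m<k-r = trans (at-++ʳ Zs (Qs ++ Cs) m length-Zs)
    (trans (at-++ˡ Qs Cs length-Qs m<k-r) (at-map-upTo q m<k-r))

  C*-at-head : ∀ {i} → i < s → at (C*list k l r x) i ≡ head-x i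
  C*-at-head i<s = trans (at-++ˡ Hs Zs* length-Hs i<s) (at-map-upTo head-x i<s)

  C*-at-tail : ∀ m → at (C*list k l r x) (s + m) ≡ 0
  C*-at-tail m = trans (at-++ʳ Hs Zs* m length-Hs) (at-replicate-0 (k ∸ r + l) m)

  C-prefix : ∀ {i} → i ≤ l → sumUpTo (at (Clist k d l r x)) (suc k ∸ i) ≡ X + Y (l ∸ i)
  C-prefix {i} i≤l = begin
    sumUpTo (at (Clist k d l r x)) (suc k ∸ i)
      ≡⟨ cong (sumUpTo (at (Clist k d l r x))) (blocks-length i≤l l≤r r≤k) ⟨
    sumUpTo (at (Zs ++ Qs ++ Cs)) (s + (k ∸ r + (l ∸ i)))
      ≡⟨ sumUpTo-at-++ Zs (Qs ++ Cs) _ length-Zs ⟩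
    sum Zs + sumUpTo (at (Qs ++ Cs)) (k ∸ r + (l ∸ i))
      ≡⟨ cong₂ _+_ (sum-replicate-0 s) (sumUpTo-at-++ Qs Cs (l ∸ i) length-Qs) ⟩
    sum Qs + sumUpTo (at Cs) (l ∸ i)
      ≡⟨ cong₂ _+_ (sum-map-upTo q (k ∸ r))
           (sumUpTo-cong (l ∸ i) (λ j j<l∸i → at-map-upTo c (<-≤-trans j<l∸i (m∸n≤m l i)))) ⟩
    X + Y (l ∸ i)
      ∎
    where open ≡-Reasoning

  V≤B : V ≤ B
  V≤B = ≤-trans (vsum-toTuple-≤ k (C*list k l r x)) (≤-reflexive (begin
    sum (Hs ++ Zs*)        ≡⟨ sum-++ Hs Zs* ⟩
    sum Hs + sum Zs*       ≡⟨ cong₂ _+_ (sum-map-upTo head-x s) (sum-replicate-0 (k ∸ r + l)) ⟩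
    B + 0                  ≡⟨ +-identityʳ B ⟩
    B                      ∎))
    where open ≡-Reasoning

  full-estimate : ∀ {i} → i < l → 2 ^ i * (X + Y (l ∸ i)) ≤ d
  full-estimate {i} i<l = full-bound {2 ^ i} {2 ^ (l ∸ i)} {N} {d} {X} {Y (l ∸ i)} (2≤2^ (m<n⇒0<n∸m i<l))
    (trans (*-comm (2 ^ i) _) (trans (2^[l∸i]*2^i≡2^l (<⇒≤ i<l)) (2^≡2+2^∸2 1≤l)))
    (≤-trans X*M≤A (≤-trans (m≤m+n A B) A+B≤d)) (Y-bound (m∸n≤m l i))

  spine-estimate : ∀ {i} → i ≤ l → V * 2 ^ l ≤ d → V + mersenne i * (X + Y (l ∸ i)) ≤ d
  spine-estimate {i} i≤l V*L≤d = spine-bound {mersenne i} {2 ^ (l ∸ i)} {N} {d} {A} {V} {X} {Y (l ∸ i)}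
    (trans (cong (2 ^ (l ∸ i) *_) (suc-mersenne i)) (trans (2^[l∸i]*2^i≡2^l i≤l) (2^≡2+2^∸2 1≤l)))
    (subst (λ L → V * L ≤ d) (2^≡2+2^∸2 1≤l) V*L≤d) (≤-trans (+-monoʳ-≤ A V≤B) A+B≤d) X*M≤A
    (Y-bound (m∸n≤m l i))

  C-kd : KDVector k d (C k d l r x)
  C-kd = begin
    vsum (C k d l r x)                ≡⟨ vsum-tabulate (suc k) (at (Clist k d l r x)) ⟩
    sumUpTo (at (Clist k d l r x)) (suc k) ≡⟨ C-prefix z≤n ⟩
    X + Y l                           ≡⟨ *-identityˡ (X + Y l) ⟨
    1 * (X + Y l)                     ≤⟨ full-estimate 1≤l ⟩
    d                                 ∎
    where open ≤-Reasoning

  C*-kd : KDVector k d (C* k l r x)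
  C*-kd = ≤-trans V≤B (≤-trans (m≤n+m B A) A+B≤d)

  mersenne-l : mersenne l ≡ 2 ^ l ∸ 1
  mersenne-l = cong (_∸ 1) (suc-mersenne l)

  i≤1+k : ∀ {i} → i ≤ l → i ≤ suc k
  i≤1+k i≤l = ≤-trans i≤l (≤-trans l≤r (m≤n⇒m≤1+n r≤k))

  leavesUpTo-split : ∀ u {i} → i ≤ suc k → leavesUpTo u k ≡ leavesBelow u (i + (suc k ∸ i))
  leavesUpTo-split u i≤1+k = trans (leavesUpTo≡leavesBelow u k) (cong (leavesBelow u) (sym (m+[n∸m]≡n i≤1+k)))

  tail-index : ∀ m → l + (s + m) < suc k → m < k ∸ r
  tail-index m l+s+m<1+k = m+n≤o⇒m≤o∸n (suc m) (≤-pred (begin-strict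
    suc m + r    ≡⟨ cong suc (+-comm m r) ⟩
    suc r + m    ≡⟨ trans (sym (+-assoc l s m)) (cong (_+ m) l+s≡1+r) ⟨
    l + (s + m)  <⟨ l+s+m<1+k ⟩
    suc k        ∎))
    where open ≤-Reasoning

  -- The levels l..r come from the copy of S at depth l, the levels r+1..k from the 2^l - 1
  -- copies of T at depth l.
  C-constructible⇒ : Constructible k d (C k d l r x) → Constructible k d (C* k l r x) →
    V * 2 ^ l < d → Constructible k d x
  C-constructible⇒ C-cons C*-cons V*L<d
    with tree-of-constructible k d (Clist k d l r x) C-cons | tree-of-constructible k d (C*list k l r x) C*-cons
  ... | T , T-levels , T-sparse | S , S-levels , S-sparse =
    constructible-of-tree k d x (spine l S T) x-kd levels
      (allVertices-spine _ l S T S-sparse T-sparse full-sparse spine-sparse)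
    where
    open ≤-Reasoning

    T-below : ∀ {i} → i ≤ l → leavesBelow T (suc k ∸ i) ≤ X + Y (l ∸ i)
    T-below {i} i≤l = subst (leavesBelow T (suc k ∸ i) ≤_) (C-prefix i≤l)
      (sumUpTo-mono-≤ (suc k ∸ i) (λ j j<w → T-levels j (<-≤-trans j<w (m∸n≤m (suc k) i))))

    S-below : ∀ {w} → w ≤ suc k → leavesBelow S w ≤ V
    S-below {w} w≤1+k = begin
      leavesBelow S w                         ≤⟨ sumUpTo-mono-≤ w (λ j j<w → S-levels j (<-≤-trans j<w w≤1+k)) ⟩
      sumUpTo (at (C*list k l r x)) w         ≤⟨ sumUpTo-monoʳ-≤ (at (C*list k l r x)) w≤1+k ⟩
      sumUpTo (at (C*list k l r x)) (suc k)   ≡⟨ vsum-tabulate (suc k) (at (C*list k l r x)) ⟨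
      V                                       ∎

    full-sparse : ∀ i → i < l → leavesUpTo (full i T) k ≤ d
    full-sparse i i<l = begin
      leavesUpTo (full i T) k                   ≡⟨ leavesUpTo-split (full i T) (i≤1+k (<⇒≤ i<l)) ⟩
      leavesBelow (full i T) (i + (suc k ∸ i))  ≡⟨ leavesBelow-full i T (suc k ∸ i) ⟩
      2 ^ i * leavesBelow T (suc k ∸ i)         ≤⟨ *-monoʳ-≤ (2 ^ i) (T-below (<⇒≤ i<l)) ⟩
      2 ^ i * (X + Y (l ∸ i))                   ≤⟨ full-estimate i<l ⟩
      d                                         ∎

    spine-sparse : ∀ i → i ≤ l → leavesUpTo (spine i S T) k ≤ d
    spine-sparse i i≤l = begin
      leavesUpTo (spine i S T) k
        ≡⟨ leavesUpTo-split (spine i S T) (i≤1+k i≤l) ⟩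
      leavesBelow (spine i S T) (i + (suc k ∸ i))
        ≡⟨ leavesBelow-spine i S T (suc k ∸ i) ⟩
      leavesBelow S (suc k ∸ i) + mersenne i * leavesBelow T (suc k ∸ i)
        ≤⟨ +-mono-≤ (S-below (m∸n≤m (suc k) i)) (*-monoʳ-≤ (mersenne i) (T-below i≤l)) ⟩
      V + mersenne i * (X + Y (l ∸ i))
        ≤⟨ spine-estimate i≤l (<⇒≤ V*L<d) ⟩
      d ∎

    glued-level : ∀ i → l + i < suc k → leavesAt S i + mersenne l * leavesAt T i ≤ head-x i
    glued-level i l+i<1+k with i <? s
    ... | yes i<s = begin
      leavesAt S i + mersenne l * leavesAt T i  ≤⟨ +-mono-≤ S-level (*-monoʳ-≤ (mersenne l) T-level) ⟩
      head-x i + mersenne l * 0                 ≡⟨ trans (cong (head-x i +_) (*-zeroʳ (mersenne l))) (+-identityʳ (head-x i)) ⟩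
      head-x i                                  ∎
      where
      i<1+k = ≤-<-trans (m≤n+m i l) l+i<1+k
      S-level = subst (leavesAt S i ≤_) (C*-at-head i<s) (S-levels i i<1+k)
      T-level = subst (leavesAt T i ≤_) (C-at-head i<s) (T-levels i i<1+k)
    ... | no i≮s with m≤n⇒∃[o]m+o≡n (≮⇒≥ i≮s)
    ... | m , refl = begin
      leavesAt S (s + m) + mersenne l * leavesAt T (s + m) ≤⟨ +-mono-≤ S-level (*-monoʳ-≤ (mersenne l) T-level) ⟩
      0 + mersenne l * q m                                  ≡⟨ trans (cong (_* q m) mersenne-l) (*-comm _ (q m)) ⟩
      q m * (2 ^ l ∸ 1)                                     ≤⟨ div-*-≤ (tail-x m) (2 ^ l ∸ 1) ⟩
      tail-x m                                              ≡⟨ head-x-s+ m ⟨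
      head-x (s + m)                                        ∎
      where
      s+m<1+k = ≤-<-trans (m≤n+m (s + m) l) l+i<1+k
      S-level = subst (leavesAt S (s + m) ≤_) (C*-at-tail m) (S-levels (s + m) s+m<1+k)
      T-level = subst (leavesAt T (s + m) ≤_) (C-at-tail (tail-index m l+i<1+k)) (T-levels (s + m) s+m<1+k)

    levels : Levels≤ (spine l S T) (xat x) (suc k)
    levels j j<1+k with l ≤? j
    ... | no l≰j = ≤-trans (≤-reflexive (leavesAt-spine-< l S T (≰⇒> l≰j))) z≤n
    ... | yes l≤j with m≤n⇒∃[o]m+o≡n l≤j
    ... | i , refl = ≤-trans (≤-reflexive (leavesAt-spine l S T i)) (glued-level i j<1+k)

lemma5 : (k d l : ℕ) → 1 ≤ k → 1 ≤ d → 1 ≤ l → l ≤ k →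
    (x : Vec ℕ (suc k)) → KDVector k d x →
    (KDVector k d (E k d l x) × (Constructible k d (E k d l x) → Constructible k d x))
    × ((r : ℕ) → l ≤ r → r ≤ k →
        KDVector k d (C k d l r x) × KDVector k d (C* k l r x)
        × (Constructible k d (C k d l r x) → Constructible k d (C* k l r x) →
           vsum (C* k l r x) * 2 ^ l < d → Constructible k d x))
lemma5 k d l _ _ 1≤l _ x x-kd =
  (E-kd , E-constructible⇒) ,
  λ r l≤r r≤k → let open ViaC k d l 1≤l x x-kd r l≤r r≤k in C-kd , C*-kd , C-constructible⇒
  where open ViaE k d l 1≤l x x-kd
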